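{- If an s-hypersequent $\alpha_1\vdash\beta_1\mid\dots\mid\alpha_n\vdash\beta_n$ is provable in $\mathbf{MPDBL4}$, then it is valid in the class $\mathcal{KC}_{RT}$ of all reflexive and transitive Kripke contexts.
   Context: The logic PDBL. Variables: object variables $\mathbf{OV}$ ($p,\dots$) and property variables $\mathbf{PV}$ ($P,\dots$), disjoint countably infinite sets; constants $\top,\bot$; connectives $\sqcap,\sqcup$ (binary), $\neg,\lrcorner$ (unary). $\alpha\vee\beta:=\neg(\neg\alpha\sqcap\neg\beta)$, $\alpha\wedge\beta:=\lrcorner(\lrcorner\alpha\sqcup\lrcorner\beta)$. Sequents $\alpha\vdash\beta$ ($\alpha\dashv\vdash\beta$ means both directions); s-hypersequents are finite sequences $\alpha_1\vdash\beta_1\mid\dots\mid\alpha_n\vdash\beta_n$ (components); $B,C,\dots,X$ range over possibly empty s-hypersequents. Axioms: $\alpha\vdash\alpha$; $\alpha\sqcap\beta\vdash\alpha$; $\alpha\sqcap\beta\vdash\beta$; $\alpha\vdash\alpha\sqcup\beta$; $\beta\vdash\alpha\sqcup\beta$; $\alpha\sqcap\beta\vdash(\alpha\sqcap\beta)\sqcap(\alpha\sqcap\beta)$; $(\alpha\sqcup\beta)\sqcup(\alpha\sqcup\beta)\vdash\alpha\sqcup\beta$; $\neg(\alpha\sqcap\alpha)\vdash\neg\alpha$; $\lrcorner\alpha\vdash\lrcorner(\alpha\sqcup\alpha)$; $\alpha\sqcap\neg\alpha\vdash\bot$; $\top\vdash\alpha\sqcup\lrcorner\alpha$; $\neg\neg(\alpha\sqcap\beta)\dashv\vdash\alpha\sqcap\beta$;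 $\lrcorner\lrcorner(\alpha\sqcup\beta)\dashv\vdash\alpha\sqcup\beta$; $\alpha\sqcap\alpha\vdash\alpha\sqcap(\alpha\sqcup\beta)$; $\alpha\sqcup(\alpha\sqcap\beta)\vdash\alpha\sqcup\alpha$; $\alpha\sqcap\alpha\vdash\alpha\sqcap(\alpha\vee\beta)$; $\alpha\sqcup(\alpha\wedge\beta)\vdash\alpha\sqcup\alpha$; $\alpha\sqcap(\beta\vee\gamma)\dashv\vdash(\alpha\sqcap\beta)\vee(\alpha\sqcap\gamma)$; $\alpha\sqcup(\beta\wedge\gamma)\dashv\vdash(\alpha\sqcup\beta)\wedge(\alpha\sqcup\gamma)$; $\bot\vdash\alpha$; $\alpha\vdash\top$; $\neg\top\vdash\bot$; $\top\vdash\lrcorner\bot$; $\neg\bot\dashv\vdash\top\sqcap\top$; $\lrcorner\top\dashv\vdash\bot\sqcup\bot$; $(\alpha\sqcup\alpha)\sqcap(\alpha\sqcup\alpha)\dashv\vdash(\alpha\sqcap\alpha)\sqcup(\alpha\sqcap\alpha)$; $p\sqcap p\dashv\vdash p$ ($p\in\mathbf{OV}$); $P\sqcup P\dashv\vdash P$ ($P\in\mathbf{PV}$); (Sp) $\alpha\vdash\alpha\sqcap\alpha\mid\alpha\sqcup\alpha\vdash\alpha$. Rules: from $B\mid\alpha\vdash\beta\mid C$ infer $B\mid\alpha\sqcap\gamma\vdash\beta\sqcap\gamma\mid C$, $B\mid\gamma\sqcap\alpha\vdash\gamma\sqcap\beta\mid C$, $B\mid\alpha\sqcup\gamma\vdash\beta\sqcup\gamma\mid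 C$, $B\mid\gamma\sqcup\alpha\vdash\gamma\sqcup\beta\mid C$, $B\mid\neg\beta\vdash\neg\alpha\mid C$, $B\mid\lrcorner\beta\vdash\lrcorner\alpha\mid C$; from $B\mid\alpha\vdash\beta\mid C$ and $D\mid\beta\vdash\gamma\mid E$ infer $B\mid D\mid\alpha\vdash\gamma\mid C\mid E$; from $B\mid\alpha\sqcap\beta\vdash\alpha\sqcap\alpha\mid C$, $D\mid\alpha\sqcap\alpha\vdash\alpha\sqcap\beta\mid E$, $F\mid\alpha\sqcup\beta\vdash\beta\sqcup\beta\mid G$, $H\mid\beta\sqcup\beta\vdash\alpha\sqcup\beta\mid X$ infer $B\mid D\mid F\mid H\mid\alpha\vdash\beta\mid C\mid E\mid G\mid X$; external: from $B\mid D\mid D\mid C$ infer $B\mid D\mid C$; from $B\mid D\mid E\mid C$ infer $B\mid E\mid D\mid C$; from $B$ infer $B\mid C$. MPDBL and MPDBL4. $\mathbf{MPDBL}$ adds unary connectives $\square,\blacksquare$ (the PDBL schemes and rules range over all formulae of the enlarged language), with additional axioms $\square\alpha\sqcap\square\beta\dashv\vdash\square(\alpha\sqcap\beta)$; $\blacksquare\alpha\sqcup\blacksquare\beta\dashv\vdash\blacksquare(\alpha\sqcup\beta)$; $\square(\neg\bot)\dashv\vdash\neg\bot$; $\blacksquare(\lrcorner\top)\dashv\vdash\lrcorner\top$; $\square(\alpha\sqcap\alpha)\dashv\vdash\square\alpha$; $\blacksquare(\alpha\sqcup\alpha)\dashv\vdash\blacksquare\alpha$, and rules: from $B\mid\alpha\vdash\beta\mid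 C$ infer $B\mid\square\alpha\vdash\square\beta\mid C$ and $B\mid\blacksquare\alpha\vdash\blacksquare\beta\mid C$. $\mathbf{MPDBL4}$ is $\mathbf{MPDBL}$ plus the axioms $\square\alpha\vdash\alpha$, $\alpha\vdash\blacksquare\alpha$, $\square\square\alpha\dashv\vdash\square\alpha$, $\blacksquare\blacksquare\alpha\dashv\vdash\blacksquare\alpha$. Provability is via finite derivations. Kripke contexts and semiconcepts. A Kripke context is $\mathbb{KC}=((G,R),(M,S),I)$ where $(G,M,I)$ is a context ($I\subseteq G\times M$), $R$ is a binary relation on $G$ and $S$ a binary relation on $M$; it is reflexive (resp. transitive) if both $R$ and $S$ are reflexive (resp. transitive). For $A\subseteq G$, $A'=\{m:gIm\ \forall g\in A\}$; for $B\subseteq M$, $B'=\{g:gIm\ \forall m\in B\}$. A semiconcept of $(G,M,I)$ is a pair $(A,B)$ with $A'=B$ or $B'=A$; $ext(A,B)=A$, $int(A,B)=B$; $\mathfrak{H}$ denotes the set of semiconcepts with operations $(A_1,B_1)\sqcap(A_2,B_2)=(A_1\cap A_2,(A_1\cap A_2)')$, $(A_1,B_1)\sqcup(A_2,B_2)=((B_1\cap B_2)',B_1\cap B_2)$. Models. A model is $\mathbb{M}=(\mathbb{KC},v)$ with $v$ a map on $\mathbf{OV}\cup\mathbf{PV}\cup\{\top,\bot\}$ into $\mathfrak{H}$ with $v(p)\sqcap v(p)=v(p)$ ($p\in\mathbf{OV}$), $v(P)\sqcup v(P)=v(P)$ ($P\in\mathbf{PV}$), $v(\top)=(G,\emptyset)$,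 $v(\bot)=(\emptyset,M)$. Satisfaction $g\models\alpha$ ($g\in G$) and co-satisfaction $m\succ\alpha$ ($m\in M$): $g\models p$ iff $g\in ext(v(p))$; $g\models P$ iff $g\in ext(v(P))$; $g\models\top$ always; $g\not\models\bot$ always; $m\not\succ\top$ always; $m\succ\bot$ always; $g\models\alpha\sqcap\beta$ iff $g\models\alpha$ and $g\models\beta$; $g\models\neg\alpha$ iff $g\not\models\alpha$; $m\succ p$ iff $m\in int(v(p))$; $m\succ P$ iff $m\in int(v(P))$; $m\succ\alpha\sqcup\beta$ iff $m\succ\alpha$ and $m\succ\beta$; $m\succ\lrcorner\alpha$ iff $m\not\succ\alpha$; $g\models\alpha\sqcup\beta$ iff $\forall m(m\succ\alpha\sqcup\beta\Rightarrow gIm)$; $g\models\lrcorner\alpha$ iff $\forall m(m\not\succ\alpha\Rightarrow gIm)$; $m\succ\neg\alpha$ iff $\forall g(g\not\models\alpha\Rightarrow gIm)$; $m\succ\alpha\sqcap\beta$ iff $\forall g(g\models\alpha\sqcap\beta\Rightarrow gIm)$; $g\models\square\alpha$ iff for all $g_1$ with $gRg_1$, $g_1\models\alpha$; $m\succ\square\alpha$ iff $gIm$ for every $g\in G$ such that ($g_1\models\alpha$ for all $g_1$ with $gRg_1$); $m\succ\blacksquare\alpha$ iff for all $m_1$ with $mSm_1$, $m_1\succ\alpha$; $g\models\blacksquare\alpha$ iff $gIm$ for every $m\in M$ such that ($m_1\succ\alpha$ for all $m_1$ with $mSm_1$). A sequent $\alpha\vdash\beta$ is satisfied in $\mathbb{M}$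 iff $\forall g(g\models\alpha\Rightarrow g\models\beta)$ and $\forall m(m\succ\beta\Rightarrow m\succ\alpha)$; an s-hypersequent is satisfied iff some component is; true in $\mathbb{KC}$ iff satisfied in every model based on $\mathbb{KC}$; valid in a class iff true in each member. -}

module Defs where

open import Level using (0ℓ)
open import Data.Nat using (ℕ)
open import Data.Product using (_×_; _,_)
open import Data.Sum using (_⊎_)
open import Data.List using (List; []; _∷_; _++_)
open import Data.List.Relation.Unary.Any using (Any)
open import Relation.Nullary using (¬_)
import Data.Unit
import Data.Empty
open import Relation.Unary using (Pred; _≐_; _∩_)
open import Relation.Binary.Definitions using (Reflexive; Transitive)

-- Syntax of MPDBL (object variables ov n, property variables pv n)

infixr 7 ∼_ ⌟_ □_ ■_
infixl 6 _⊓_ _⊔_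
infix 4 _⊢_

data Fm : Set where
  ov pv : ℕ → Fm
  ⊤f ⊥f : Fm
  _⊓_ _⊔_ : Fm → Fm → Fm
  ∼_ ⌟_ □_ ■_ : Fm → Fm

_∨_ : Fm → Fm → Fm
α ∨ β = ∼ (∼ α ⊓ ∼ β)

_∧_ : Fm → Fm → Fm
α ∧ β = ⌟ (⌟ α ⊔ ⌟ β)

record Seq : Set where
  constructor _⊢_
  field
    lhs rhs : Fm

HSeq : Set
HSeq = List Seq

-- Single-sequent axioms of MPDBL4 (⊣⊢ gives two constructors)

data Ax4 : Seq → Set where
  a-id    : ∀ {α} → Ax4 (α ⊢ α)
  a-⊓₁    : ∀ {α β} → Ax4 (α ⊓ β ⊢ α)
  a-⊓₂    : ∀ {α β} → Ax4 (α ⊓ β ⊢ β)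
  a-⊔₁    : ∀ {α β} → Ax4 (α ⊢ α ⊔ β)
  a-⊔₂    : ∀ {α β} → Ax4 (β ⊢ α ⊔ β)
  a-⊓dup  : ∀ {α β} → Ax4 (α ⊓ β ⊢ (α ⊓ β) ⊓ (α ⊓ β))
  a-⊔dup  : ∀ {α β} → Ax4 ((α ⊔ β) ⊔ (α ⊔ β) ⊢ α ⊔ β)
  a-∼⊓    : ∀ {α} → Ax4 (∼ (α ⊓ α) ⊢ ∼ α)
  a-⌟⊔    : ∀ {α} → Ax4 (⌟ α ⊢ ⌟ (α ⊔ α))
  a-contr : ∀ {α} → Ax4 (α ⊓ ∼ α ⊢ ⊥f)
  a-exm   : ∀ {α} → Ax4 (⊤f ⊢ α ⊔ ⌟ α)
  a-∼∼₁   : ∀ {α β} → Ax4 (∼ ∼ (α ⊓ β) ⊢ α ⊓ β)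
  a-∼∼₂   : ∀ {α β} → Ax4 (α ⊓ β ⊢ ∼ ∼ (α ⊓ β))
  a-⌟⌟₁   : ∀ {α β} → Ax4 (⌟ ⌟ (α ⊔ β) ⊢ α ⊔ β)
  a-⌟⌟₂   : ∀ {α β} → Ax4 (α ⊔ β ⊢ ⌟ ⌟ (α ⊔ β))
  a-abs₁  : ∀ {α β} → Ax4 (α ⊓ α ⊢ α ⊓ (α ⊔ β))
  a-abs₂  : ∀ {α β} → Ax4 (α ⊔ (α ⊓ β) ⊢ α ⊔ α)
  a-abs₃  : ∀ {α β} → Ax4 (α ⊓ α ⊢ α ⊓ (α ∨ β))
  a-abs₄  : ∀ {α β} → Ax4 (α ⊔ (α ∧ β) ⊢ α ⊔ α)
  a-dist₁ : ∀ {α β γ} → Ax4 (α ⊓ (β ∨ γ) ⊢ (α ⊓ β) ∨ (α ⊓ γ))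
  a-dist₂ : ∀ {α β γ} → Ax4 ((α ⊓ β) ∨ (α ⊓ γ) ⊢ α ⊓ (β ∨ γ))
  a-dist₃ : ∀ {α β γ} → Ax4 (α ⊔ (β ∧ γ) ⊢ (α ⊔ β) ∧ (α ⊔ γ))
  a-dist₄ : ∀ {α β γ} → Ax4 ((α ⊔ β) ∧ (α ⊔ γ) ⊢ α ⊔ (β ∧ γ))
  a-⊥     : ∀ {α} → Ax4 (⊥f ⊢ α)
  a-⊤     : ∀ {α} → Ax4 (α ⊢ ⊤f)
  a-∼⊤    : Ax4 (∼ ⊤f ⊢ ⊥f)
  a-⌟⊥    : Ax4 (⊤f ⊢ ⌟ ⊥f)
  a-∼⊥₁   : Ax4 (∼ ⊥f ⊢ ⊤f ⊓ ⊤f)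
  a-∼⊥₂   : Ax4 (⊤f ⊓ ⊤f ⊢ ∼ ⊥f)
  a-⌟⊤₁   : Ax4 (⌟ ⊤f ⊢ ⊥f ⊔ ⊥f)
  a-⌟⊤₂   : Ax4 (⊥f ⊔ ⊥f ⊢ ⌟ ⊤f)
  a-mix₁  : ∀ {α} → Ax4 ((α ⊔ α) ⊓ (α ⊔ α) ⊢ (α ⊓ α) ⊔ (α ⊓ α))
  a-mix₂  : ∀ {α} → Ax4 ((α ⊓ α) ⊔ (α ⊓ α) ⊢ (α ⊔ α) ⊓ (α ⊔ α))
  a-ov₁   : ∀ {n} → Ax4 (ov n ⊓ ov n ⊢ ov n)
  a-ov₂   : ∀ {n} → Ax4 (ov n ⊢ ov n ⊓ ov n)
  a-pv₁   : ∀ {n} → Ax4 (pv n ⊔ pv n ⊢ pv n)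
  a-pv₂   : ∀ {n} → Ax4 (pv n ⊢ pv n ⊔ pv n)
  a-□⊓₁   : ∀ {α β} → Ax4 (□ α ⊓ □ β ⊢ □ (α ⊓ β))
  a-□⊓₂   : ∀ {α β} → Ax4 (□ (α ⊓ β) ⊢ □ α ⊓ □ β)
  a-■⊔₁   : ∀ {α β} → Ax4 (■ α ⊔ ■ β ⊢ ■ (α ⊔ β))
  a-■⊔₂   : ∀ {α β} → Ax4 (■ (α ⊔ β) ⊢ ■ α ⊔ ■ β)
  a-□∼⊥₁  : Ax4 (□ (∼ ⊥f) ⊢ ∼ ⊥f)
  a-□∼⊥₂  : Ax4 (∼ ⊥f ⊢ □ (∼ ⊥f))
  a-■⌟⊤₁  : Ax4 (■ (⌟ ⊤f) ⊢ ⌟ ⊤f)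
  a-■⌟⊤₂  : Ax4 (⌟ ⊤f ⊢ ■ (⌟ ⊤f))
  a-□idem₁ : ∀ {α} → Ax4 (□ (α ⊓ α) ⊢ □ α)
  a-□idem₂ : ∀ {α} → Ax4 (□ α ⊢ □ (α ⊓ α))
  a-■idem₁ : ∀ {α} → Ax4 (■ (α ⊔ α) ⊢ ■ α)
  a-■idem₂ : ∀ {α} → Ax4 (■ α ⊢ ■ (α ⊔ α))
  a-T     : ∀ {α} → Ax4 (□ α ⊢ α)
  a-Tb    : ∀ {α} → Ax4 (α ⊢ ■ α)
  a-4₁    : ∀ {α} → Ax4 (□ □ α ⊢ □ α)
  a-4₂    : ∀ {α} → Ax4 (□ α ⊢ □ □ α)
  a-4b₁   : ∀ {α} → Ax4 (■ ■ α ⊢ ■ α)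
  a-4b₂   : ∀ {α} → Ax4 (■ α ⊢ ■ ■ α)

data Prov : HSeq → Set where
  ax   : ∀ {s} → Ax4 s → Prov (s ∷ [])
  sp   : ∀ {α} → Prov ((α ⊢ α ⊓ α) ∷ (α ⊔ α ⊢ α) ∷ [])
  r-⊓ʳ : ∀ {B C α β γ} → Prov (B ++ (α ⊢ β) ∷ C) → Prov (B ++ (α ⊓ γ ⊢ β ⊓ γ) ∷ C)
  r-⊓ˡ : ∀ {B C α β γ} → Prov (B ++ (α ⊢ β) ∷ C) → Prov (B ++ (γ ⊓ α ⊢ γ ⊓ β) ∷ C)
  r-⊔ʳ : ∀ {B C α β γ} → Prov (B ++ (α ⊢ β) ∷ C) → Prov (B ++ (α ⊔ γ ⊢ β ⊔ γ) ∷ C)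
  r-⊔ˡ : ∀ {B C α β γ} → Prov (B ++ (α ⊢ β) ∷ C) → Prov (B ++ (γ ⊔ α ⊢ γ ⊔ β) ∷ C)
  r-∼  : ∀ {B C α β} → Prov (B ++ (α ⊢ β) ∷ C) → Prov (B ++ (∼ β ⊢ ∼ α) ∷ C)
  r-⌟  : ∀ {B C α β} → Prov (B ++ (α ⊢ β) ∷ C) → Prov (B ++ (⌟ β ⊢ ⌟ α) ∷ C)
  r-□  : ∀ {B C α β} → Prov (B ++ (α ⊢ β) ∷ C) → Prov (B ++ (□ α ⊢ □ β) ∷ C)
  r-■  : ∀ {B C α β} → Prov (B ++ (α ⊢ β) ∷ C) → Prov (B ++ (■ α ⊢ ■ β) ∷ C)
  r-cut : ∀ {B C D E α β γ} →
          Prov (B ++ (α ⊢ β) ∷ C) → Prov (D ++ (β ⊢ γ) ∷ E) →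
          Prov (B ++ D ++ (α ⊢ γ) ∷ C ++ E)
  r-4  : ∀ {B C D E F G H X α β} →
         Prov (B ++ (α ⊓ β ⊢ α ⊓ α) ∷ C) →
         Prov (D ++ (α ⊓ α ⊢ α ⊓ β) ∷ E) →
         Prov (F ++ (α ⊔ β ⊢ β ⊔ β) ∷ G) →
         Prov (H ++ (β ⊔ β ⊢ α ⊔ β) ∷ X) →
         Prov (B ++ D ++ F ++ H ++ (α ⊢ β) ∷ C ++ E ++ G ++ X)
  e-contr : ∀ {B C D} → Prov (B ++ D ++ D ++ C) → Prov (B ++ D ++ C)
  e-exch  : ∀ {B C D E} → Prov (B ++ D ++ E ++ C) → Prov (B ++ E ++ D ++ C)
  e-weak  : ∀ {B C} → Prov B → Prov (B ++ C)

record KripkeContext : Set₁ where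
  field
    G M : Set
    R   : G → G → Set
    S   : M → M → Set
    I   : G → M → Set

record IsReflTrans (K : KripkeContext) : Set where
  open KripkeContext K
  field
    R-refl  : Reflexive R
    S-refl  : Reflexive S
    R-trans : Transitive R
    S-trans : Transitive S

module _ (K : KripkeContext) where
  open KripkeContext K

  _′ᴳ : Pred G 0ℓ → Pred M 0ℓ
  A ′ᴳ = λ m → ∀ g → A g → I g m

  _′ᴹ : Pred M 0ℓ → Pred G 0ℓ
  B ′ᴹ = λ g → ∀ m → B m → I g m

  record Semiconcept : Set₁ where
    field
      ext : Pred G 0ℓ
      int : Pred M 0ℓ
      semi : ((ext ′ᴳ) ≐ int) ⊎ ((int ′ᴹ) ≐ ext)

  open Semiconcept public

  _⊓ˢ_ : Semiconcept → Semiconcept → Semiconcept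
  x ⊓ˢ y = record { ext = ext x ∩ ext y ; int = (ext x ∩ ext y) ′ᴳ
                  ; semi = _⊎_.inj₁ ((λ z → z) , (λ z → z)) }

  _⊔ˢ_ : Semiconcept → Semiconcept → Semiconcept
  x ⊔ˢ y = record { ext = (int x ∩ int y) ′ᴹ ; int = int x ∩ int y
                  ; semi = _⊎_.inj₂ ((λ z → z) , (λ z → z)) }

  _≈ˢ_ : Semiconcept → Semiconcept → Set
  x ≈ˢ y = (ext x ≐ ext y) × (int x ≐ int y)

  -- valuations (v(⊤) = (G,∅), v(⊥) = (∅,M) are fixed and built into
  -- the satisfaction clauses for ⊤f, ⊥f)
  record Valuation : Set₁ where
    field
      vo : ℕ → Semiconcept
      vp : ℕ → Semiconcept
      vo-idem : ∀ n → (vo n ⊓ˢ vo n) ≈ˢ vo n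
      vp-idem : ∀ n → (vp n ⊔ˢ vp n) ≈ˢ vp n

  open Valuation public

  module _ (v : Valuation) where
    mutual
      _⊨_ : G → Fm → Set
      g ⊨ ov n = ext (vo v n) g
      g ⊨ pv n = ext (vp v n) g
      g ⊨ ⊤f = Data.Unit.⊤
      g ⊨ ⊥f = Data.Empty.⊥
      g ⊨ (α ⊓ β) = (g ⊨ α) × (g ⊨ β)
      g ⊨ (α ⊔ β) = ∀ m → (m ≻ α) × (m ≻ β) → I g m
      g ⊨ (∼ α) = ¬ (g ⊨ α)
      g ⊨ (⌟ α) = ∀ m → ¬ (m ≻ α) → I g m
      g ⊨ (□ α) = ∀ g₁ → R g g₁ → g₁ ⊨ α
      g ⊨ (■ α) = ∀ m → (∀ m₁ → S m m₁ → m₁ ≻ α) → I g m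

      _≻_ : M → Fm → Set
      m ≻ ov n = int (vo v n) m
      m ≻ pv n = int (vp v n) m
      m ≻ ⊤f = Data.Empty.⊥
      m ≻ ⊥f = Data.Unit.⊤
      m ≻ (α ⊓ β) = ∀ g → (g ⊨ α) × (g ⊨ β) → I g m
      m ≻ (α ⊔ β) = (m ≻ α) × (m ≻ β)
      m ≻ (∼ α) = ∀ g → ¬ (g ⊨ α) → I g m
      m ≻ (⌟ α) = ¬ (m ≻ α)
      m ≻ (□ α) = ∀ g → (∀ g₁ → R g g₁ → g₁ ⊨ α) → I g m
      m ≻ (■ α) = ∀ m₁ → S m m₁ → m₁ ≻ α

    SatSeq : Seq → Set
    SatSeq (α ⊢ β) = (∀ g → g ⊨ α → g ⊨ β) × (∀ m → m ≻ β → m ≻ α)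

    SatH : HSeq → Set
    SatH H = Any SatSeq H

  TrueIn : HSeq → Set₁
  TrueIn H = (v : Valuation) → SatH v H

ValidRT : HSeq → Set₁
ValidRT H = (K : KripkeContext) → IsReflTrans K → TrueIn K H

{-# OPTIONS --safe #-}
-- Every formula α denotes a semiconcept ⟦ α ⟧ = ({g ∣ g ⊨ α}, {m ∣ m ≻ α}), and
-- a sequent α ⊢ β is satisfied exactly when ⟦ α ⟧ ≤ ⟦ β ⟧ for the order in which
-- extents grow and intents shrink.  A semiconcept always satisfies ext ⊆ int′,
-- so when int = ext′ (formulas built by ⊓, ∼, □) the order is decided by extents
-- alone, and when ext = int′ (formulas built by ⊔, ⌟, ■) by intents alone: almost
-- every axiom and rule needs checking on one side only.  Reflexivity and
-- transitivity of R and S give the T and 4 axioms; excluded middle is used only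
-- for the double-negation and distributivity axioms, where ∼ and ⌟ must be read
-- classically.
module Submission where

open import Level using (0ℓ)
open import Axiom.ExcludedMiddle using (ExcludedMiddle)
open import Axiom.DoubleNegationElimination using (em⇒dne)
open import Data.Empty using (⊥-elim)
open import Data.Unit using (tt)
open import Data.Product using (_×_; _,_; proj₁; proj₂; <_,_>)
open import Data.Sum using (_⊎_; inj₁; inj₂; [_,_]′)
import Data.Sum as Sum
open import Data.List using ([]; _∷_; _++_)
open import Data.List.Relation.Unary.Any using (Any; here; there)
import Data.List.Relation.Unary.Any as Any
open import Data.List.Relation.Unary.Any.Properties using (++⁺ˡ; ++⁺ʳ; ++⁻)
open import Data.List.Relation.Binary.Sublist.Propositional
  using (_∷_; _∷ʳ_; ⊆-refl; lookup) renaming (_⊆_ to _⊆ˡ_)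
open import Data.List.Relation.Binary.Sublist.Propositional.Properties
  using () renaming (++⁺ to ⊆-++⁺; ++⁺ˡ to ⊆-++ˡ; ++⁺ʳ to ⊆-++ʳ)
open import Function using (_∘_; id)
open import Relation.Binary.PropositionalEquality using (refl)
open import Relation.Nullary using (¬_; yes; no)
open import Relation.Unary using (Pred; _⊆_; _≐_; ∁)
open import Defs hiding (_′ᴳ; _′ᴹ; _⊓ˢ_; _⊔ˢ_; _≈ˢ_; _⊨_; _≻_)
import Defs

module _ {a p} {A : Set a} {P : Pred A p} where

  Any-map-suffix : ∀ B {xs ys} → (Any P xs → Any P ys) → Any P (B ++ xs) → Any P (B ++ ys)
  Any-map-suffix B f q = [ ++⁺ˡ , ++⁺ʳ B ∘ f ]′ (++⁻ B q)

  Any-replace : ∀ B {x y C} → (P x → P y) → Any P (B ++ x ∷ C) → Any P (B ++ y ∷ C)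
  Any-replace B f = Any-map-suffix B λ { (here px) → here (f px) ; (there q) → there q }

  Any-contract : ∀ B D {C} → Any P (B ++ D ++ D ++ C) → Any P (B ++ D ++ C)
  Any-contract B D = Any-map-suffix B λ q → [ ++⁺ˡ , id ]′ (++⁻ D q)

  Any-exchange : ∀ B D E {C} → Any P (B ++ D ++ E ++ C) → Any P (B ++ E ++ D ++ C)
  Any-exchange B D E = Any-map-suffix B λ q →
    [ ++⁺ʳ E ∘ ++⁺ˡ , [ ++⁺ˡ , ++⁺ʳ E ∘ ++⁺ʳ D ]′ ∘ ++⁻ E ]′ (++⁻ D q)

  Any-focus : ∀ B {x C} → Any P (B ++ x ∷ C) → P x ⊎ Any P (B ++ C)
  Any-focus []      (here px) = inj₁ px
  Any-focus []      (there q) = inj₂ q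
  Any-focus (b ∷ B) (here pb) = inj₂ (here pb)
  Any-focus (b ∷ B) (there q) = Sum.map₂ there (Any-focus B q)

  Any-cut : ∀ B D {x y z C E} → (P x → P y → P z) →
            Any P (B ++ x ∷ C) → Any P (D ++ y ∷ E) → Any P (B ++ D ++ z ∷ C ++ E)
  Any-cut B D {z = z} {C} {E} f p q with Any-focus B p | Any-focus D q
  ... | inj₂ bc | _       = lookup (⊆-++⁺ (⊆-refl {x = B}) (⊆-++ˡ D (z ∷ʳ ⊆-++ʳ E ⊆-refl))) bc
  ... | inj₁ _  | inj₂ de = lookup (⊆-++ˡ B (⊆-++⁺ (⊆-refl {x = D}) (z ∷ʳ ⊆-++ˡ C ⊆-refl))) de
  ... | inj₁ px | inj₁ py = ++⁺ʳ B (++⁺ʳ D (here (f px py)))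

infixr 2 _∨ᶜ_
_∨ᶜ_ : Set → Set → Set
A ∨ᶜ B = ¬ (¬ A × ¬ B)

×-distribˡ-∨ᶜ : {A B C : Set} → A × (B ∨ᶜ C) → (A × B) ∨ᶜ (A × C)
×-distribˡ-∨ᶜ (a , b∨c) (¬ab , ¬ac) = b∨c ((λ b → ¬ab (a , b)) , (λ c → ¬ac (a , c)))

×-distribˡ-∨ᶜ⁻ : ExcludedMiddle 0ℓ → {A B C : Set} → (A × B) ∨ᶜ (A × C) → A × (B ∨ᶜ C)
×-distribˡ-∨ᶜ⁻ lem {A} ab∨ac with lem {A}
... | yes a  = a , λ (¬b , ¬c) → ab∨ac ((λ (_ , b) → ¬b b) , (λ (_ , c) → ¬c c))
... | no ¬a = ⊥-elim (ab∨ac ((λ (a , _) → ¬a a) , (λ (a , _) → ¬a a)))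

module Semiconcepts (K : KripkeContext) where
  open KripkeContext K

  _′ᴳ : Pred G 0ℓ → Pred M 0ℓ
  _′ᴳ = Defs._′ᴳ K

  _′ᴹ : Pred M 0ℓ → Pred G 0ℓ
  _′ᴹ = Defs._′ᴹ K

  infixl 6 _⊓ˢ_ _⊔ˢ_
  _⊓ˢ_ _⊔ˢ_ : Semiconcept K → Semiconcept K → Semiconcept K
  _⊓ˢ_ = Defs._⊓ˢ_ K
  _⊔ˢ_ = Defs._⊔ˢ_ K

  infix 4 _≈ˢ_
  _≈ˢ_ : Semiconcept K → Semiconcept K → Set
  _≈ˢ_ = Defs._≈ˢ_ K

  ext-I-int : (x : Semiconcept K) {g : G} {m : M} → ext x g → int x m → I g m
  ext-I-int x e i with semi x
  ... | inj₁ (_ , int⊆ext′) = int⊆ext′ i _ e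
  ... | inj₂ (_ , ext⊆int′) = ext⊆int′ e _ i

  ′-closed : (x : Semiconcept K) → (ext x ′ᴳ ⊆ int x) ⊎ (int x ′ᴹ ⊆ ext x)
  ′-closed x = Sum.map proj₁ proj₁ (semi x)

  I-of-polars : (x : Semiconcept K) {g : G} {m : M} → (ext x ′ᴳ) m → (int x ′ᴹ) g → I g m
  I-of-polars x m∈ext′ g∈int′ with ′-closed x
  ... | inj₁ ext′⊆int = g∈int′ _ (ext′⊆int m∈ext′)
  ... | inj₂ int′⊆ext = m∈ext′ _ (int′⊆ext g∈int′)

  infix 4 _≤_
  record _≤_ (x y : Semiconcept K) : Set where
    constructor mk≤
    field
      ext⊆ : ∀ g → ext x g → ext y g
      int⊇ : ∀ m → int y m → int x m

  ≤-refl : ∀ {x} → x ≤ x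
  ≤-refl = mk≤ (λ _ → id) (λ _ → id)

  ≤-trans : ∀ {x y z} → x ≤ y → y ≤ z → x ≤ z
  ≤-trans (mk≤ f b) (mk≤ f′ b′) = mk≤ (λ g → f′ g ∘ f g) (λ m → b m ∘ b′ m)

  ≤-by-ext : ∀ {x y} → ext x ′ᴳ ⊆ int x → (∀ g → ext x g → ext y g) → x ≤ y
  ≤-by-ext {y = y} ext′⊆int f = mk≤ f λ m i → ext′⊆int (λ g e → ext-I-int y (f g e) i)

  ≤-by-int : ∀ {x y} → int y ′ᴹ ⊆ ext y → (∀ m → int y m → int x m) → x ≤ y
  ≤-by-int {x} int′⊆ext b = mk≤ (λ g e → int′⊆ext (λ m i → ext-I-int x e (b m i))) b

  ⊓ˢ-monoˡ : ∀ {x y} z → x ≤ y → x ⊓ˢ z ≤ y ⊓ˢ z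
  ⊓ˢ-monoˡ z (mk≤ f _) = ≤-by-ext id λ g (e , e′) → f g e , e′

  ⊓ˢ-monoʳ : ∀ {x y} z → x ≤ y → z ⊓ˢ x ≤ z ⊓ˢ y
  ⊓ˢ-monoʳ z (mk≤ f _) = ≤-by-ext id λ g (e′ , e) → e′ , f g e

  ⊔ˢ-monoˡ : ∀ {x y} z → x ≤ y → x ⊔ˢ z ≤ y ⊔ˢ z
  ⊔ˢ-monoˡ z (mk≤ _ b) = ≤-by-int id λ m (i , i′) → b m i , i′

  ⊔ˢ-monoʳ : ∀ {x y} z → x ≤ y → z ⊔ˢ x ≤ z ⊔ˢ y
  ⊔ˢ-monoʳ z (mk≤ _ b) = ≤-by-int id λ m (i′ , i) → i′ , b m i

  ≤-⊓ˢ-idem⊎⊔ˢ-idem-≤ : ∀ x → x ≤ x ⊓ˢ x ⊎ x ⊔ˢ x ≤ x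
  ≤-⊓ˢ-idem⊎⊔ˢ-idem-≤ x with ′-closed x
  ... | inj₁ ext′⊆int = inj₁ (≤-by-ext ext′⊆int λ g e → e , e)
  ... | inj₂ int′⊆ext = inj₂ (≤-by-int int′⊆ext λ m i → i , i)

  ≤-from-idem : ∀ {x y} → x ⊓ˢ x ≤ x ⊓ˢ y → x ⊔ˢ y ≤ y ⊔ˢ y → x ≤ y
  ≤-from-idem (mk≤ f _) (mk≤ _ b) = mk≤ (λ g e → proj₂ (f g (e , e))) (λ m i → proj₁ (b m (i , i)))

  ¬ˢ_ ⌟ˢ_ □ˢ_ ■ˢ_ : Semiconcept K → Semiconcept K
  ¬ˢ x = record { ext = ∁ (ext x) ; int = ∁ (ext x) ′ᴳ ; semi = inj₁ (id , id) }
  ⌟ˢ x = record { ext = ∁ (int x) ′ᴹ ; int = ∁ (int x) ; semi = inj₂ (id , id) }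
  □ˢ x = record { ext = □ext ; int = □ext ′ᴳ ; semi = inj₁ (id , id) }
    where □ext = λ g → ∀ g₁ → R g g₁ → ext x g₁
  ■ˢ x = record { ext = ■int ′ᴹ ; int = ■int ; semi = inj₂ (id , id) }
    where ■int = λ m → ∀ m₁ → S m m₁ → int x m₁

  ¬ˢ-antitone : ∀ {x y} → x ≤ y → ¬ˢ y ≤ ¬ˢ x
  ¬ˢ-antitone (mk≤ f _) = ≤-by-ext id λ g ¬e e → ¬e (f g e)

  ⌟ˢ-antitone : ∀ {x y} → x ≤ y → ⌟ˢ y ≤ ⌟ˢ x
  ⌟ˢ-antitone (mk≤ _ b) = ≤-by-int id λ m ¬i i → ¬i (b m i)

  □ˢ-mono : ∀ {x y} → x ≤ y → □ˢ x ≤ □ˢ y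
  □ˢ-mono (mk≤ f _) = ≤-by-ext id λ g e g₁ r → f g₁ (e g₁ r)

  ■ˢ-mono : ∀ {x y} → x ≤ y → ■ˢ x ≤ ■ˢ y
  ■ˢ-mono (mk≤ _ b) = ≤-by-int id λ m i m₁ s → b m₁ (i m₁ s)

  ⊓ˢ-⊔ˢ-interchange : ∀ x → (x ⊔ˢ x) ⊓ˢ (x ⊔ˢ x) ≤ (x ⊓ˢ x) ⊔ˢ (x ⊓ˢ x)
  ⊓ˢ-⊔ˢ-interchange x = ≤-by-ext id λ _ (e , _) _ (i , _) →
    I-of-polars x (λ g a → i g (a , a)) (λ m b → e m (b , b))

  ⊔ˢ-⊓ˢ-interchange : ∀ x → (x ⊓ˢ x) ⊔ˢ (x ⊓ˢ x) ≤ (x ⊔ˢ x) ⊓ˢ (x ⊔ˢ x)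
  ⊔ˢ-⊓ˢ-interchange x = mk≤ (λ _ h → < id , id > λ m (i , _) → h m (ι i , ι i))
                            (λ _ h → < id , id > λ g (e , _) → h g (κ e , κ e))
    where
    ι : ∀ {m} → int x m → int (x ⊓ˢ x) m
    ι i g (e , _) = ext-I-int x e i
    κ : ∀ {g} → ext x g → ext (x ⊔ˢ x) g
    κ e m (i , _) = ext-I-int x e i

  ⊓ˢ-idem⇒ext′⊆int : ∀ {x} → x ⊓ˢ x ≈ˢ x → ext x ′ᴳ ⊆ int x
  ⊓ˢ-idem⇒ext′⊆int (_ , (int⊓⊆int , _)) m∈ext′ = int⊓⊆int λ g (e , _) → m∈ext′ g e

  ⊔ˢ-idem⇒int′⊆ext : ∀ {x} → x ⊔ˢ x ≈ˢ x → int x ′ᴹ ⊆ ext x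
  ⊔ˢ-idem⇒int′⊆ext ((ext⊔⊆ext , _) , _) g∈int′ = ext⊔⊆ext λ m (i , _) → g∈int′ m i

module Denotation (K : KripkeContext) (v : Valuation K) where
  open KripkeContext K
  open Semiconcepts K

  infix 4 _⊨_ _≻_
  _⊨_ : G → Fm → Set
  _⊨_ = Defs._⊨_ K v

  _≻_ : M → Fm → Set
  _≻_ = Defs._≻_ K v

  fm-semi : ∀ α → ((_⊨ α) ′ᴳ ≐ (_≻ α)) ⊎ ((_≻ α) ′ᴹ ≐ (_⊨ α))
  fm-semi (ov n)  = semi (vo v n)
  fm-semi (pv n)  = semi (vp v n)
  fm-semi ⊤f      = inj₂ ((λ _ → tt) , λ _ _ ())
  fm-semi ⊥f      = inj₁ ((λ _ → tt) , λ _ _ ())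
  fm-semi (α ⊓ β) = inj₁ (id , id)
  fm-semi (α ⊔ β) = inj₂ (id , id)
  fm-semi (∼ α)   = inj₁ (id , id)
  fm-semi (⌟ α)   = inj₂ (id , id)
  fm-semi (□ α)   = inj₁ (id , id)
  fm-semi (■ α)   = inj₂ (id , id)

  ⟦_⟧ : Fm → Semiconcept K
  ⟦ α ⟧ = record { ext = _⊨ α ; int = _≻ α ; semi = fm-semi α }

  Holds : Seq → Set
  Holds (α ⊢ β) = ⟦ α ⟧ ≤ ⟦ β ⟧

  Holds⇒SatSeq : ∀ {s} → Holds s → SatSeq K v s
  Holds⇒SatSeq (mk≤ f b) = f , b

module Soundness (lem : ExcludedMiddle 0ℓ) (K : KripkeContext) (rt : IsReflTrans K)
                 (v : Valuation K) where
  open IsReflTrans rt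
  open Semiconcepts K
  open Denotation K v

  dne : {A : Set} → ¬ ¬ A → A
  dne = em⇒dne lem

  ov-ext′⊆int : ∀ n → ext ⟦ ov n ⟧ ′ᴳ ⊆ int ⟦ ov n ⟧
  ov-ext′⊆int n = ⊓ˢ-idem⇒ext′⊆int {vo v n} (vo-idem v n)

  pv-int′⊆ext : ∀ n → int ⟦ pv n ⟧ ′ᴹ ⊆ ext ⟦ pv n ⟧
  pv-int′⊆ext n = ⊔ˢ-idem⇒int′⊆ext {vp v n} (vp-idem v n)

  Ax4-sound : ∀ {s} → Ax4 s → Holds s
  Ax4-sound a-id     = ≤-refl
  Ax4-sound a-⊓₁     = ≤-by-ext id λ _ → proj₁
  Ax4-sound a-⊓₂     = ≤-by-ext id λ _ → proj₂
  Ax4-sound a-⊔₁     = ≤-by-int id λ _ → proj₁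
  Ax4-sound a-⊔₂     = ≤-by-int id λ _ → proj₂
  Ax4-sound a-⊓dup   = ≤-by-ext id λ _ e → e , e
  Ax4-sound a-⊔dup   = ≤-by-int id λ _ i → i , i
  Ax4-sound a-∼⊓     = ≤-by-ext id λ _ ¬ee e → ¬ee (e , e)
  Ax4-sound a-⌟⊔     = ≤-by-int id λ _ ¬ii i → ¬ii (i , i)
  Ax4-sound a-contr  = ≤-by-ext id λ _ (e , ¬e) → ¬e e
  Ax4-sound a-exm    = ≤-by-int id λ _ (i , ¬i) → ¬i i
  Ax4-sound a-∼∼₁    = ≤-by-ext id λ _ → dne
  Ax4-sound a-∼∼₂    = ≤-by-ext id λ _ e ¬e → ¬e e
  Ax4-sound a-⌟⌟₁    = ≤-by-int id λ _ i ¬i → ¬i i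
  Ax4-sound a-⌟⌟₂    = ≤-by-int id λ _ → dne
  Ax4-sound (a-abs₁ {α}) = ≤-by-ext id λ _ (e , _) → e , λ _ (i , _) → ext-I-int ⟦ α ⟧ e i
  Ax4-sound (a-abs₂ {α}) = ≤-by-int id λ _ (i , _) → i , λ _ (e , _) → ext-I-int ⟦ α ⟧ e i
  Ax4-sound a-abs₃   = ≤-by-ext id λ _ (e , _) → e , λ (¬e , _) → ¬e e
  Ax4-sound a-abs₄   = ≤-by-int id λ _ (i , _) → i , λ (¬i , _) → ¬i i
  Ax4-sound a-dist₁  = ≤-by-ext id λ _ → ×-distribˡ-∨ᶜ
  Ax4-sound a-dist₂  = ≤-by-ext id λ _ → ×-distribˡ-∨ᶜ⁻ lem
  Ax4-sound a-dist₃  = ≤-by-int id λ _ → ×-distribˡ-∨ᶜ⁻ lem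
  Ax4-sound a-dist₄  = ≤-by-int id λ _ → ×-distribˡ-∨ᶜ
  Ax4-sound a-⊥      = ≤-by-ext (λ _ → tt) λ _ ()
  Ax4-sound a-⊤      = ≤-by-int (λ _ → tt) λ _ ()
  Ax4-sound a-∼⊤     = ≤-by-ext id λ _ ¬⊤ → ¬⊤ tt
  Ax4-sound a-⌟⊥     = ≤-by-int id λ _ ¬⊥ → ¬⊥ tt
  Ax4-sound a-∼⊥₁    = ≤-by-ext id λ _ _ → tt , tt
  Ax4-sound a-∼⊥₂    = ≤-by-ext id λ _ _ ()
  Ax4-sound a-⌟⊤₁    = ≤-by-int id λ _ _ ()
  Ax4-sound a-⌟⊤₂    = ≤-by-int id λ _ _ → tt , tt
  Ax4-sound (a-mix₁ {α}) = ⊓ˢ-⊔ˢ-interchange ⟦ α ⟧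
  Ax4-sound (a-mix₂ {α}) = ⊔ˢ-⊓ˢ-interchange ⟦ α ⟧
  Ax4-sound a-ov₁    = ≤-by-ext id λ _ → proj₁
  Ax4-sound (a-ov₂ {n}) = ≤-by-ext (ov-ext′⊆int n) λ _ e → e , e
  Ax4-sound (a-pv₁ {n}) = ≤-by-int (pv-int′⊆ext n) λ _ i → i , i
  Ax4-sound a-pv₂    = ≤-by-int id λ _ → proj₁
  Ax4-sound a-□⊓₁    = ≤-by-ext id λ _ (a , b) g₁ r → a g₁ r , b g₁ r
  Ax4-sound a-□⊓₂    = ≤-by-ext id λ _ ab → (λ g₁ → proj₁ ∘ ab g₁) , (λ g₁ → proj₂ ∘ ab g₁)
  Ax4-sound a-■⊔₁    = ≤-by-int id λ _ ab → (λ m₁ → proj₁ ∘ ab m₁) , (λ m₁ → proj₂ ∘ ab m₁)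
  Ax4-sound a-■⊔₂    = ≤-by-int id λ _ (a , b) m₁ s → a m₁ s , b m₁ s
  Ax4-sound a-□∼⊥₁   = ≤-by-ext id λ _ _ ()
  Ax4-sound a-□∼⊥₂   = ≤-by-ext id λ _ _ _ _ ()
  Ax4-sound a-■⌟⊤₁   = ≤-by-int id λ _ _ _ _ ()
  Ax4-sound a-■⌟⊤₂   = ≤-by-int id λ _ _ ()
  Ax4-sound a-□idem₁ = ≤-by-ext id λ _ aa g₁ → proj₁ ∘ aa g₁
  Ax4-sound a-□idem₂ = ≤-by-ext id λ _ a g₁ r → a g₁ r , a g₁ r
  Ax4-sound a-■idem₁ = ≤-by-int id λ _ a m₁ s → a m₁ s , a m₁ s
  Ax4-sound a-■idem₂ = ≤-by-int id λ _ aa m₁ → proj₁ ∘ aa m₁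
  Ax4-sound a-T      = ≤-by-ext id λ g a → a g R-refl
  Ax4-sound a-Tb     = ≤-by-int id λ m a → a m S-refl
  Ax4-sound a-4₁     = ≤-by-ext id λ _ a g₁ r → a g₁ r g₁ R-refl
  Ax4-sound a-4₂     = ≤-by-ext id λ _ a g₁ r g₂ r′ → a g₂ (R-trans r r′)
  Ax4-sound a-4b₁    = ≤-by-int id λ _ a m₁ s m₂ s′ → a m₂ (S-trans s s′)
  Ax4-sound a-4b₂    = ≤-by-int id λ _ a m₁ s → a m₁ s m₁ S-refl

  sound : ∀ {H} → Prov H → Any Holds H
  sound (ax a)                   = here (Ax4-sound a)
  sound (sp {α})                 = [ here , there ∘ here ]′ (≤-⊓ˢ-idem⊎⊔ˢ-idem-≤ ⟦ α ⟧)
  sound (r-⊓ʳ {B} {γ = γ} p)     = Any-replace B (⊓ˢ-monoˡ ⟦ γ ⟧) (sound p)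
  sound (r-⊓ˡ {B} {γ = γ} p)     = Any-replace B (⊓ˢ-monoʳ ⟦ γ ⟧) (sound p)
  sound (r-⊔ʳ {B} {γ = γ} p)     = Any-replace B (⊔ˢ-monoˡ ⟦ γ ⟧) (sound p)
  sound (r-⊔ˡ {B} {γ = γ} p)     = Any-replace B (⊔ˢ-monoʳ ⟦ γ ⟧) (sound p)
  sound (r-∼ {B} p)              = Any-replace B ¬ˢ-antitone (sound p)
  sound (r-⌟ {B} p)              = Any-replace B ⌟ˢ-antitone (sound p)
  sound (r-□ {B} p)              = Any-replace B □ˢ-mono (sound p)
  sound (r-■ {B} p)              = Any-replace B ■ˢ-mono (sound p)
  sound (r-cut {B} {D = D} p q)  = Any-cut B D ≤-trans (sound p) (sound q)
  sound (r-4 {B} {C} {D} {E} {F} {G′} {H} {X} {α} {β} _ p q _) =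
    lookup embedding (Any-cut D F ≤-from-idem (sound p) (sound q))
    where
    embedding : D ++ F ++ (α ⊢ β) ∷ E ++ G′ ⊆ˡ B ++ D ++ F ++ H ++ (α ⊢ β) ∷ C ++ E ++ G′ ++ X
    embedding = ⊆-++ˡ B (⊆-++⁺ (⊆-refl {x = D}) (⊆-++⁺ (⊆-refl {x = F})
                  (⊆-++ˡ H (refl ∷ ⊆-++ˡ C (⊆-++⁺ (⊆-refl {x = E}) (⊆-++ʳ X ⊆-refl))))))
  sound (e-contr {B} {D = D} p)  = Any-contract B D (sound p)
  sound (e-exch {B} {D = D} {E} p) = Any-exchange B D E (sound p)
  sound (e-weak p)               = ++⁺ˡ (sound p)

theorem82 : ExcludedMiddle 0ℓ → (H : HSeq) → Prov H → ValidRT H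
theorem82 lem H p K rt v = Any.map (λ {s} → Holds⇒SatSeq {s}) (sound p)
  where
  open Denotation K v using (Holds⇒SatSeq)
  open Soundness lem K rt v using (sound)
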